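{- For $n\ge1$, consider the Kentucky-2 legal decompositions of all integers $m\in[0,a_{2n+1})$; for a decomposition $m=a_{\ell_1}+\cdots+a_{\ell_k}$ with $\ell_1<\cdots<\ell_k$ its gaps are the numbers $\ell_2-\ell_1,\dots,\ell_k-\ell_{k-1}$ (counted with multiplicity). Let $P_n(g)$ be the fraction, among all gaps arising from all these decompositions, of gaps equal to $g$. Then $P(g):=\lim_{n\to\infty}P_n(g)$ exists for every $g\ge0$, with $P(0)=P(1)=P(2)=0$, $P(3)=1/8$, and for $g\ge4$, \[ P(g)=\begin{cases}2^{ -j} & \text{if } g=2j,\\ \tfrac34\,2^{ -j} & \text{if } g=2j+1.\end{cases} \]
   Context: The Kentucky-2 sequence $(a_n)_{n\ge1}$: index $\ell$ belongs to bin $\lceil \ell/2\rceil$. A legal decomposition of $m\ge0$ using $\{a_1,\dots,a_N\}$ is $m=a_{\ell_1}+\cdots+a_{\ell_k}$, $k\ge0$, $1\le\ell_1<\cdots<\ell_k\le N$, with $\lceil \ell_{j+1}/2\rceil-\lceil \ell_j/2\rceil\ge2$ for all $j$. The sequence is defined by $a_1=1$ and, for $N\ge1$, $a_{N+1}$ is the smallest positive integer with no legal decomposition using $\{a_1,\dots,a_N\}$ (first terms $1,2,3,4,5,8,11,16,\dots$). Every nonnegative integer has a unique legal decomposition. -}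

module Defs where

open import Data.Nat as ℕ using (ℕ; zero; suc; _+_; _*_; _∸_; _^_; _≤_; _<_; ⌈_/2⌉)
open import Data.Nat.Properties using (m^n≢0; _≟_)
open import Data.Integer using (+_)
open import Data.Rational as ℚ using (ℚ; _/_; 0ℚ)
open import Data.List using (List; []; _∷_; map; length; filter; upTo)
open import Data.Nat.ListAction using (sum)
open import Data.List.Relation.Unary.All using (All)
open import Data.List.Relation.Unary.Linked using (Linked)
open import Data.Product using (Σ; _×_)
open import Relation.Binary.PropositionalEquality using (_≡_)
open import Relation.Nullary using (¬_)

-- Sequences are functions ℕ → ℕ indexed from 1 (the value at 0 is irrelevant).

bin : ℕ → ℕ
bin ℓ = ⌈ ℓ /2⌉

LegalStep : ℕ → ℕ → Set
LegalStep ℓ ℓ' = (ℓ < ℓ') × (2 + bin ℓ ≤ bin ℓ')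

LegalIndices : ℕ → List ℕ → Set
LegalIndices N ℓs = All (λ ℓ → (1 ≤ ℓ) × (ℓ ≤ N)) ℓs × Linked LegalStep ℓs

LegalDecompUsing : (ℕ → ℕ) → ℕ → List ℕ → ℕ → Set
LegalDecompUsing a N ℓs m = LegalIndices N ℓs × (sum (map a ℓs) ≡ m)

HasLegalDecomp : (ℕ → ℕ) → ℕ → ℕ → Set
HasLegalDecomp a N m = Σ (List ℕ) (λ ℓs → LegalDecompUsing a N ℓs m)

LegalDecomp : (ℕ → ℕ) → List ℕ → ℕ → Set
LegalDecomp a ℓs m = Σ ℕ (λ N → LegalDecompUsing a N ℓs m)

IsKentucky2 : (ℕ → ℕ) → Set
IsKentucky2 a =
  (a 1 ≡ 1) ×
  ((N : ℕ) → 1 ≤ N →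
     (0 < a (suc N)) ×
     (¬ HasLegalDecomp a N (a (suc N))) ×
     ((m : ℕ) → 0 < m → m < a (suc N) → HasLegalDecomp a N m))

gaps : List ℕ → List ℕ
gaps [] = []
gaps (x ∷ []) = []
gaps (x ∷ y ∷ r) = (y ∸ x) ∷ gaps (y ∷ r)

countGap : ℕ → List ℕ → ℕ
countGap g ℓs = length (filter (g ≟_) (gaps ℓs))

totalGaps : (ℕ → ℕ) → (ℕ → List ℕ) → ℕ → ℕ
totalGaps a dec n = sum (map (λ m → length (gaps (dec m))) (upTo (a (suc (2 * n)))))

gapCount : (ℕ → ℕ) → (ℕ → List ℕ) → ℕ → ℕ → ℕ
gapCount a dec n g = sum (map (λ m → countGap g (dec m)) (upTo (a (suc (2 * n)))))

-- P_n(g) = (number of gaps equal to g) / (total number of gaps);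
-- convention: 0 when there are no gaps at all (only affects finitely many n)
Pn : (ℕ → ℕ) → (ℕ → List ℕ) → ℕ → ℕ → ℚ
Pn a dec n g with totalGaps a dec n
... | zero = 0ℚ
... | suc t = (+ gapCount a dec n g) / suc t

Plim : ℕ → ℚ
Plim 0 = 0ℚ
Plim 1 = 0ℚ
Plim 2 = 0ℚ
Plim 3 = (+ 1) / 8
Plim (suc (suc (suc (suc k)))) = go (suc (suc (suc (suc k))))
  where
    go : ℕ → ℚ
    go g with ℕ.⌊ g /2⌋ | g ℕ.% 2
    ... | j | 0 = _/_ (+ 1) (2 ^ j) {{m^n≢0 2 j}}
    ... | j | _ = _/_ (+ 3) (2 ^ (2 + j)) {{m^n≢0 2 (2 + j)}}  -- = (3/4)·2^{-j}

ConvergesTo : (ℕ → ℚ) → ℚ → Set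
ConvergesTo s L = (ε : ℚ) → 0ℚ ℚ.< ε →
  Σ ℕ (λ N → (n : ℕ) → N ≤ n → ℚ.∣ s n ℚ.- L ∣ ℚ.< ε)

module Submission where

-- Let maxPred x = 2 (bin x − 2), the largest index allowed before x.  A legal
-- list ending in N+1 is a legal list within maxPred (N+1) followed by N+1; by
-- strong induction this yields a (N+2) = a (N+1) + a (maxPred (N+1) + 1) and
-- uniqueness of decompositions.  So the decompositions of 0, …, a (2n+1) − 1
-- are exactly legalLists (n+1), built blockwise by appending 2n+1 or 2n+2.
-- Any gap statistic summed over legalLists n solves X (n+2) = X (n+1) + 2 X n +
-- forcing n, and the forcings are explicit in the Jacobsthal numbers J, which
-- satisfy J (j + m) ≈ 2^j J m.  Hence q·(forcing of gaps g) ≈ p·(forcing of all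
-- gaps) up to O(1) with p/q the claimed limit, the solutions differ by O(2^n),
-- and since the total number of gaps grows like n 2^n the ratio tends to p/q.
-- Gaps 0, 1, 2 never occur because consecutive legal indices differ by ≥ 3.


open import Defs
open import Data.Nat as ℕ using (ℕ; zero; suc; _+_; _*_; _∸_; _^_; _≤_; _<_; z≤n; s≤s; _⊔_; _<?_; _≤?_; ⌊_/2⌋; _%_)
open import Data.Nat.DivMod using (m*n%n≡0; [m+kn]%n≡m%n)
open import Data.Nat.Properties
open import Data.Nat.Induction using (<-rec)
open import Data.Nat.Tactic.RingSolver using (solve-∀)
open import Data.Nat.ListAction using (sum)
open import Data.Nat.ListAction.Properties using (sum-++)
open import Data.Integer as ℤ using (+[1+_]; -[1+_]; _⊖_)
import Data.Integer.Properties as ℤP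
open import Data.Rational as ℚ using (ℚ; mkℚ; 0ℚ; _/_; toℚᵘ; ↧ₙ_)
import Data.Rational.Properties as ℚP
open import Data.Rational.Unnormalised as ℚᵘ using (ℚᵘ; mkℚᵘ; *<*) renaming (_≃_ to _≃ᵘ_; _<_ to _<ᵘ_)
import Data.Rational.Unnormalised.Properties as ℚᵘP
open import Data.List using (List; []; _∷_; _++_; _∷ʳ_; [_]; map; length; filter; upTo; applyUpTo; initLast; _∷ʳ′_)
open import Data.List.Properties using (map-++; map-cong; map-∘; map-id-local; map-upTo; filter-accept; filter-reject; filter-none; ++-assoc; length-++; length-map)
open import Data.List.Relation.Unary.All as All using (All; []; _∷_)
import Data.List.Relation.Unary.All.Properties as AllP
open import Data.List.Relation.Unary.Linked using (Linked; []; [-]; _∷_)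
open import Data.Product using (Σ; _×_; _,_; proj₁; proj₂)
open import Data.Sum using (_⊎_; inj₁; inj₂)
open import Data.Empty using (⊥-elim)
open import Function using (_∘_)
open import Relation.Binary.PropositionalEquality using (_≡_; _≢_; refl; sym; trans; cong; cong₂; subst; subst₂; module ≡-Reasoning)
open import Relation.Nullary using (¬_; yes; no)
open import Relation.Nullary.Decidable using (toWitness)

-- Bins.  Indices 2k−1 and 2k form bin k; bin (2 + y) = suc (bin y) holds by computation.

double-suc : ∀ k → 2 * suc k ≡ 2 + 2 * k
double-suc k = cong suc (+-suc k (k + 0))

bin-double : ∀ k → bin (2 * k) ≡ k
bin-double zero    = refl
bin-double (suc k) = trans (cong bin (double-suc k)) (cong suc (bin-double k))

bin-odd : ∀ k → bin (suc (2 * k)) ≡ suc k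
bin-odd zero    = refl
bin-odd (suc k) = trans (cong (bin ∘ suc) (double-suc k)) (cong suc (bin-odd k))

bin-even : ∀ k → bin (2 + 2 * k) ≡ suc k
bin-even k = cong suc (bin-double k)

bin≤⇒≤double : ∀ y k → bin y ≤ k → y ≤ 2 * k
bin≤⇒≤double zero          k       _       = z≤n
bin≤⇒≤double (suc zero)    (suc k) _       = s≤s z≤n
bin≤⇒≤double (suc (suc y)) (suc k) (s≤s h) =
  subst (2 + y ≤_) (sym (double-suc k)) (s≤s (s≤s (bin≤⇒≤double y k h)))

≤double⇒bin≤ : ∀ y k → y ≤ 2 * k → bin y ≤ k
≤double⇒bin≤ y k h = subst (bin y ≤_) (bin-double k) (⌈n/2⌉-mono h)

double-bin≤ : ∀ y → 2 * bin y ≤ suc y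
double-bin≤ zero          = z≤n
double-bin≤ (suc zero)    = ≤-refl
double-bin≤ (suc (suc y)) = ≤-trans (≤-reflexive (double-suc (bin y))) (s≤s (s≤s (double-bin≤ y)))

bin<⇒< : ∀ {y x} → bin y < bin x → y < x
bin<⇒< {y} {x} h = ≰⇒> (λ x≤y → <⇒≱ h (⌈n/2⌉-mono x≤y))

-- maxPred x = 2 (bin x − 2) is the largest index allowed to precede x in a
-- legal decomposition: for y ≥ 1, LegalStep y x holds iff y ≤ maxPred x.
maxPred : ℕ → ℕ
maxPred x = 2 * (bin x ∸ 2)

legalStep⇒≤maxPred : ∀ {y x} → LegalStep y x → y ≤ maxPred x
legalStep⇒≤maxPred {y} {x} (_ , bins) =
  bin≤⇒≤double y (bin x ∸ 2) (m+n≤o⇒m≤o∸n (bin y) (≤-trans (≤-reflexive (+-comm (bin y) 2)) bins))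

≤maxPred⇒legalStep : ∀ {y x} → 1 ≤ y → y ≤ maxPred x → LegalStep y x
≤maxPred⇒legalStep {y} {x} 1≤y y≤max = bin<⇒< (≤-trans (n≤1+n _) bins) , bins
  where
  bin-y≤ : bin y ≤ bin x ∸ 2
  bin-y≤ = ≤double⇒bin≤ y (bin x ∸ 2) y≤max
  2≤bin-x : 2 ≤ bin x
  2≤bin-x = <⇒≤ (m∸n≢0⇒n<m (λ eq → <⇒≢ (≤-trans (⌈n/2⌉-mono 1≤y) bin-y≤) (sym eq)))
  bins : 2 + bin y ≤ bin x
  bins = ≤-trans (≤-reflexive (+-comm 2 (bin y)))
           (m≤o∸n⇒m+n≤o (bin y) 2≤bin-x bin-y≤)

-- Every legal predecessor is smaller, so recursion along maxPred is well founded.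
maxPred<self : ∀ x → 1 ≤ x → maxPred x < x
maxPred<self x 1≤x with maxPred x in eq
... | zero  = 1≤x
... | suc p = proj₁ (≤maxPred⇒legalStep {suc p} {x} (s≤s z≤n) (≤-reflexive (sym eq)))

maxPred-odd : ∀ k → maxPred (suc (2 * k)) ≡ 2 * (k ∸ 1)
maxPred-odd k = cong (λ b → 2 * (b ∸ 2)) (bin-odd k)

maxPred-even : ∀ k → maxPred (2 + 2 * k) ≡ 2 * (k ∸ 1)
maxPred-even k = cong (λ b → 2 * (b ∸ 2)) (bin-even k)

-- Legal lists.  The key structural fact: a list ending in x is legal within N
-- iff 1 ≤ x ≤ N and its initial part is legal within maxPred x.

legal-weaken : ∀ {N N′} ℓs → N ≤ N′ → LegalIndices N ℓs → LegalIndices N′ ℓs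
legal-weaken ℓs N≤N′ (bounds , linked) = All.map (λ (1≤ℓ , ℓ≤N) → 1≤ℓ , ≤-trans ℓ≤N N≤N′) bounds , linked

legal-zero : ∀ ℓs → LegalIndices 0 ℓs → ℓs ≡ []
legal-zero []      _                     = refl
legal-zero (ℓ ∷ _) (((1≤ℓ , ℓ≤0) ∷ _) , _) = ⊥-elim (<⇒≱ 1≤ℓ ℓ≤0)

-- LegalStep is transitive, so every element of a legal list is a legal predecessor of the last one.
legalStep-trans : ∀ {x y z} → LegalStep x y → LegalStep y z → LegalStep x z
legalStep-trans (x<y , bxy) (y<z , byz) = <-trans x<y y<z , ≤-trans bxy (≤-trans (m≤n+m _ 2) byz)

linked-∷ʳ⁻ : ∀ ini x → Linked LegalStep (ini ∷ʳ x) →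
             Linked LegalStep ini × All (λ y → LegalStep y x) ini
linked-∷ʳ⁻ []            x _        = [] , []
linked-∷ʳ⁻ (y ∷ [])      x (r ∷ [-]) = [-] , r ∷ []
linked-∷ʳ⁻ (y ∷ z ∷ ini) x (r ∷ rs) with linked-∷ʳ⁻ (z ∷ ini) x rs
... | linked , (s ∷ ss) = r ∷ linked , legalStep-trans r s ∷ s ∷ ss

linked-∷ʳ⁺ : ∀ ini x → Linked LegalStep ini → All (λ y → LegalStep y x) ini →
             Linked LegalStep (ini ∷ʳ x)
linked-∷ʳ⁺ []            x _        _        = [-]
linked-∷ʳ⁺ (y ∷ [])      x _        (s ∷ []) = s ∷ [-]
linked-∷ʳ⁺ (y ∷ z ∷ ini) x (r ∷ rs) (_ ∷ ss) = r ∷ linked-∷ʳ⁺ (z ∷ ini) x rs ss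

legal-∷ʳ⁺ : ∀ {N} ini x → 1 ≤ x → x ≤ N → LegalIndices (maxPred x) ini → LegalIndices N (ini ∷ʳ x)
legal-∷ʳ⁺ ini x 1≤x x≤N (bounds , linked) =
  AllP.∷ʳ⁺ (All.map (λ (1≤y , y≤max) → 1≤y , ≤-trans y≤max (≤-trans (<⇒≤ (maxPred<self x 1≤x)) x≤N)) bounds) (1≤x , x≤N) ,
  linked-∷ʳ⁺ ini x linked (All.map (λ (1≤y , y≤max) → ≤maxPred⇒legalStep 1≤y y≤max) bounds)

legal-∷ʳ⁻ : ∀ {N} ini x → LegalIndices N (ini ∷ʳ x) →
            (1 ≤ x) × (x ≤ N) × LegalIndices (maxPred x) ini
legal-∷ʳ⁻ ini x (bounds , linked) with AllP.∷ʳ⁻ bounds | linked-∷ʳ⁻ ini x linked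
... | ini-bounds , (1≤x , x≤N) | ini-linked , steps =
  1≤x , x≤N ,
  All.zipWith (λ ((1≤y , _) , step) → 1≤y , legalStep⇒≤maxPred step) (ini-bounds , steps) ,
  ini-linked

legal-split : ∀ {N} ℓs → LegalIndices (suc N) ℓs →
  LegalIndices N ℓs ⊎ Σ (List ℕ) (λ ini → (ℓs ≡ ini ∷ʳ suc N) × LegalIndices (maxPred (suc N)) ini)
legal-split ℓs legal with initLast ℓs
legal-split .[] legal | [] = inj₁ ([] , [])
legal-split .(ini ∷ʳ x) legal | ini ∷ʳ′ x with legal-∷ʳ⁻ ini x legal
... | 1≤x , x≤1+N , ini-legal with m≤n⇒m<n∨m≡n x≤1+N
...   | inj₂ refl        = inj₂ (ini , refl , ini-legal)
...   | inj₁ (s≤s x≤N)   = inj₁ (legal-∷ʳ⁺ ini x 1≤x x≤N ini-legal)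

legalStep-gap : ∀ {y x} → LegalStep y x → 3 ≤ x ∸ y
legalStep-gap {y} {x} (_ , bins) = m+n≤o⇒m≤o∸n 3 3+y≤x
  where
  3+y≤x : 3 + y ≤ x
  3+y≤x = ≤-pred (begin
    4 + y           ≤⟨ +-monoʳ-≤ 4 (bin≤⇒≤double y (bin y) ≤-refl) ⟩
    4 + 2 * bin y   ≡⟨ sym (*-distribˡ-+ 2 2 (bin y)) ⟩
    2 * (2 + bin y) ≤⟨ *-monoʳ-≤ 2 bins ⟩
    2 * bin x       ≤⟨ double-bin≤ x ⟩
    suc x           ∎)
    where open ≤-Reasoning

legal-gaps≥3 : ∀ {ℓs} → Linked LegalStep ℓs → All (3 ≤_) (gaps ℓs)
legal-gaps≥3 []             = []
legal-gaps≥3 [-]            = []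
legal-gaps≥3 (step ∷ steps) = legalStep-gap step ∷ legal-gaps≥3 steps

countGap-small : ∀ g → g ≤ 2 → ∀ {ℓs} → Linked LegalStep ℓs → countGap g ℓs ≡ 0
countGap-small g g≤2 linked =
  cong length (filter-none (g ≟_) (All.map (λ 3≤v g≡v → <⇒≱ (s≤s g≤2) (subst (3 ≤_) (sym g≡v) 3≤v)) (legal-gaps≥3 linked)))

value : (ℕ → ℕ) → List ℕ → ℕ
value a ℓs = sum (map a ℓs)

value-∷ʳ : ∀ a ini x → value a (ini ∷ʳ x) ≡ a x + value a ini
value-∷ʳ a ini x = begin
  sum (map a (ini ∷ʳ x))        ≡⟨ cong sum (map-++ a ini [ x ]) ⟩
  sum (map a ini ++ [ a x ])    ≡⟨ sum-++ (map a ini) [ a x ] ⟩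
  value a ini + (a x + 0)       ≡⟨ cong (value a ini +_) (+-identityʳ (a x)) ⟩
  value a ini + a x             ≡⟨ +-comm (value a ini) (a x) ⟩
  a x + value a ini             ∎
  where open ≡-Reasoning

module KentuckyRecurrence (a : ℕ → ℕ) (K : IsKentucky2 a) where

  a1≡1 : a 1 ≡ 1
  a1≡1 = proj₁ K

  a-pos : ∀ N → 0 < a (suc N)
  a-pos zero    = subst (0 <_) (sym a1≡1) (s≤s z≤n)
  a-pos (suc N) = proj₁ (proj₂ K (suc N) (s≤s z≤n))

  Exact : ℕ → Set
  Exact N = (∀ ℓs → LegalIndices N ℓs → value a ℓs < a (suc N)) ×
            (∀ m → m < a (suc N) → HasLegalDecomp a N m)

  -- the claimed value of a (N+2)
  next : ℕ → ℕ
  next N = a (suc N) + a (suc (maxPred (suc N)))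

  -- Splitting legal lists within N+1 by whether they use N+1 shows that their
  -- values are exactly [0, next N); minimality of a (N+2) then gives a (N+2) = next N.
  module Step (N : ℕ) (exact-N : Exact N) (exact-M : Exact (maxPred (suc N))) where

    values-below : ∀ ℓs → LegalIndices (suc N) ℓs → value a ℓs < next N
    values-below ℓs legal with legal-split ℓs legal
    ... | inj₁ legal-N = ≤-trans (proj₁ exact-N ℓs legal-N) (m≤m+n _ _)
    ... | inj₂ (ini , refl , legal-ini) =
      subst (_< next N) (sym (value-∷ʳ a ini (suc N))) (+-monoʳ-< (a (suc N)) (proj₁ exact-M ini legal-ini))

    -- every m < next N is decomposable, using N+1 iff m ≥ a (N+1)
    decomposable : ∀ m → m < next N → HasLegalDecomp a (suc N) m
    decomposable m m<next with m <? a (suc N)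
    ... | yes m<a with proj₂ exact-N m m<a
    ...   | ℓs , legal , sum≡m = ℓs , legal-weaken ℓs (n≤1+n N) legal , sum≡m
    decomposable m m<next | no m≮a with proj₂ exact-M (m ∸ a (suc N)) rest<
      where
      rest< : m ∸ a (suc N) < a (suc (maxPred (suc N)))
      rest< = +-cancelˡ-< (a (suc N)) _ _ (subst (_< next N) (sym (m+[n∸m]≡n (≮⇒≥ m≮a))) m<next)
    ... | ini , legal , sum≡rest =
      ini ∷ʳ suc N , legal-∷ʳ⁺ ini (suc N) (s≤s z≤n) ≤-refl legal ,
      trans (value-∷ʳ a ini (suc N))
        (trans (cong (a (suc N) +_) sum≡rest) (m+[n∸m]≡n (≮⇒≥ m≮a)))

    a-next : a (2 + N) ≡ next N
    a-next = ≤-antisym (≮⇒≥ a<next-impossible) (≮⇒≥ (λ next<a → not-decomposable (decomposable _ next<a)))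
      where
      not-decomposable : ¬ HasLegalDecomp a (suc N) (a (2 + N))
      not-decomposable = proj₁ (proj₂ (proj₂ K (suc N) (s≤s z≤n)))
      below-decomposable : ∀ m → 0 < m → m < a (2 + N) → HasLegalDecomp a (suc N) m
      below-decomposable = proj₂ (proj₂ (proj₂ K (suc N) (s≤s z≤n)))
      a<next-impossible : ¬ next N < a (2 + N)
      a<next-impossible next<a with below-decomposable (next N) (<-≤-trans (a-pos N) (m≤m+n _ _)) next<a
      ... | ℓs , legal , sum≡next = <-irrefl sum≡next (values-below ℓs legal)

    exact-suc : Exact (suc N)
    exact-suc rewrite a-next = values-below , decomposable

  exact : ∀ N → Exact N
  exact = <-rec Exact step
    where
    step : ∀ N → (∀ {M} → M < N → Exact M) → Exact N
    step zero    _  = (λ ℓs legal → subst (λ l → value a l < a 1) (sym (legal-zero ℓs legal)) (a-pos 0)) ,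
                      (λ m m<a1 → subst (HasLegalDecomp a 0) (sym (n<1⇒n≡0 (subst (m <_) a1≡1 m<a1)))
                                    ([] , ([] , []) , refl))
    step (suc N) ih = Step.exact-suc N (ih ≤-refl) (ih (s≤s (≤-pred (maxPred<self (suc N) (s≤s z≤n)))))

  recurrence : ∀ N → a (2 + N) ≡ a (suc N) + a (suc (maxPred (suc N)))
  recurrence N = Step.a-next N (exact N) (exact (maxPred (suc N)))

  too-big : ∀ {N} ℓs → LegalIndices N ℓs → ∀ ini → value a ℓs ≢ value a (ini ∷ʳ suc N)
  too-big {N} ℓs l ini same = <⇒≱ (proj₁ (exact N) ℓs l)
    (subst (a (suc N) ≤_) (sym (trans same (value-∷ʳ a ini (suc N)))) (m≤m+n _ _))

  unique : ∀ N ℓs ℓs′ → LegalIndices N ℓs → LegalIndices N ℓs′ → value a ℓs ≡ value a ℓs′ → ℓs ≡ ℓs′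
  unique zero    ℓs ℓs′ legal legal′ _ = trans (legal-zero ℓs legal) (sym (legal-zero ℓs′ legal′))
  unique (suc N) ℓs ℓs′ legal legal′ same with legal-split ℓs legal | legal-split ℓs′ legal′
  ... | inj₁ l | inj₁ l′ = unique N ℓs ℓs′ l l′ same
  ... | inj₁ l | inj₂ (ini′ , refl , _) = ⊥-elim (too-big ℓs l ini′ same)
  ... | inj₂ (ini , refl , _) | inj₁ l′ = ⊥-elim (too-big ℓs′ l′ ini (sym same))
  ... | inj₂ (ini , refl , l) | inj₂ (ini′ , refl , l′) =
    cong (_∷ʳ suc N) (unique N ini ini′ (legal-weaken ini M≤N l) (legal-weaken ini′ M≤N l′)
      (+-cancelˡ-≡ (a (suc N)) _ _ (trans (sym (value-∷ʳ a ini (suc N))) (trans same (value-∷ʳ a ini′ (suc N))))))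
    where
    M≤N : maxPred (suc N) ≤ N
    M≤N = ≤-pred (maxPred<self (suc N) (s≤s z≤n))

-- Enumeration.  legalLists n lists the legal index lists with indices at most
-- 2(n−1) in increasing order of value: first those avoiding bin n, then those
-- ending in 2n−1, then those ending in 2n (whose initial parts avoid bin n−1).
legalLists : ℕ → List (List ℕ)
legalLists 0             = [ [] ]
legalLists 1             = [ [] ]
legalLists (suc (suc n)) =
  legalLists (suc n) ++ (map (_∷ʳ suc (2 * n)) (legalLists n) ++ map (_∷ʳ (2 + 2 * n)) (legalLists n))

legalLists-legal : ∀ n → All (LegalIndices (2 * (n ∸ 1))) (legalLists n)
legalLists-legal 0             = ([] , []) ∷ []
legalLists-legal 1             = ([] , []) ∷ []
legalLists-legal (suc (suc n)) =
  AllP.++⁺ (All.map (legal-weaken _ (≤-trans (n≤1+n _) 2n+1≤)) (legalLists-legal (suc n)))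
    (AllP.++⁺ (extend (suc (2 * n)) (s≤s z≤n) 2n+1≤ (maxPred-odd n))
              (extend (2 + 2 * n) (s≤s z≤n) 2n+2≤ (maxPred-even n)))
  where
  2n+2≤ : 2 + 2 * n ≤ 2 * suc n
  2n+2≤ = ≤-reflexive (sym (double-suc n))
  2n+1≤ : suc (2 * n) ≤ 2 * suc n
  2n+1≤ = ≤-trans (n≤1+n _) 2n+2≤
  extend : ∀ x → 1 ≤ x → x ≤ 2 * suc n → maxPred x ≡ 2 * (n ∸ 1) →
           All (LegalIndices (2 * suc n)) (map (_∷ʳ x) (legalLists n))
  extend x 1≤x x≤ maxPred≡ = AllP.map⁺ (All.map
    (λ {ini} legal → legal-∷ʳ⁺ ini x 1≤x x≤ (subst (λ M → LegalIndices M ini) (sym maxPred≡) legal))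
    (legalLists-legal n))

upTo-+ : ∀ x y → upTo (x + y) ≡ upTo x ++ map (x +_) (upTo y)
upTo-+ x y = trans (applyUpTo-+ (λ z → z) x y) (cong (upTo x ++_) (sym (map-upTo (x +_) y)))
  where
  applyUpTo-+ : ∀ (f : ℕ → ℕ) x y → applyUpTo f (x + y) ≡ applyUpTo f x ++ applyUpTo (f ∘ (x +_)) y
  applyUpTo-+ f zero    y = refl
  applyUpTo-+ f (suc x) y = cong (f 0 ∷_) (applyUpTo-+ (f ∘ suc) x y)

-- By the recurrence, the values of legalLists n are consecutive, so by uniqueness
-- legalLists (n+1) is exactly the list of decompositions of 0, …, a (2n+1) − 1.
module Enumeration (a : ℕ → ℕ) (K : IsKentucky2 a) where
  open KentuckyRecurrence a K

  values-∷ʳ : ∀ z L → map (value a) (map (_∷ʳ z) L) ≡ map (a z +_) (map (value a) L)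
  values-∷ʳ z L = trans (sym (map-∘ L)) (trans (map-cong (λ l → value-∷ʳ a l z) L) (map-∘ L))

  legalLists-values : ∀ n → map (value a) (legalLists n) ≡ upTo (a (suc (2 * (n ∸ 1))))
  legalLists-values 0             = cong upTo (sym a1≡1)
  legalLists-values 1             = cong upTo (sym a1≡1)
  legalLists-values (suc (suc n)) = begin
    map (value a) (legalLists (suc n) ++ (map (_∷ʳ x) L ++ map (_∷ʳ y) L))
      ≡⟨ map-++ (value a) (legalLists (suc n)) _ ⟩
    map (value a) (legalLists (suc n)) ++ map (value a) (map (_∷ʳ x) L ++ map (_∷ʳ y) L)
      ≡⟨ cong (map (value a) (legalLists (suc n)) ++_) (map-++ (value a) (map (_∷ʳ x) L) _) ⟩
    map (value a) (legalLists (suc n)) ++ (map (value a) (map (_∷ʳ x) L) ++ map (value a) (map (_∷ʳ y) L))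
      ≡⟨ cong₂ _++_ (legalLists-values (suc n)) (cong₂ _++_ (shifted x) (shifted y)) ⟩
    upTo (a x) ++ (map (a x +_) (upTo A) ++ map (a y +_) (upTo A))
      ≡⟨ sym (++-assoc (upTo (a x)) _ _) ⟩
    (upTo (a x) ++ map (a x +_) (upTo A)) ++ map (a y +_) (upTo A)
      ≡⟨ cong (_++ map (a y +_) (upTo A)) (sym (upTo-+ (a x) A)) ⟩
    upTo (a x + A) ++ map (a y +_) (upTo A)
      ≡⟨ cong (λ v → upTo v ++ map (a y +_) (upTo A)) (sym a-y) ⟩
    upTo (a y) ++ map (a y +_) (upTo A)
      ≡⟨ sym (upTo-+ (a y) A) ⟩
    upTo (a y + A)
      ≡⟨ cong upTo (sym a-next) ⟩
    upTo (a (suc (2 * suc n))) ∎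
    where
    open ≡-Reasoning
    L : List (List ℕ)
    L = legalLists n
    x : ℕ
    x = suc (2 * n)
    y : ℕ
    y = 2 + 2 * n
    A = a (suc (2 * (n ∸ 1)))
    shifted : ∀ z → map (value a) (map (_∷ʳ z) L) ≡ map (a z +_) (upTo A)
    shifted z = trans (values-∷ʳ z L) (cong (map (a z +_)) (legalLists-values n))
    a-y : a y ≡ a x + A
    a-y = trans (recurrence (2 * n)) (cong (λ M → a x + a (suc M)) (maxPred-odd n))
    a-next : a (suc (2 * suc n)) ≡ a y + A
    a-next = trans (cong (a ∘ suc) (double-suc n))
               (trans (recurrence (suc (2 * n))) (cong (λ M → a y + a (suc M)) (maxPred-even n)))

  module _ (dec : ℕ → List ℕ) (dec-legal : (m : ℕ) → LegalDecomp a (dec m) m) where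

    dec-enumerates : ∀ n → map dec (upTo (a (suc (2 * n)))) ≡ legalLists (suc n)
    dec-enumerates n = begin
      map dec (upTo (a (suc (2 * n))))            ≡⟨ cong (map dec) (sym (legalLists-values (suc n))) ⟩
      map dec (map (value a) (legalLists (suc n))) ≡⟨ sym (map-∘ (legalLists (suc n))) ⟩
      map (dec ∘ value a) (legalLists (suc n))    ≡⟨ map-id-local (All.map (dec-value _) (legalLists-legal (suc n))) ⟩
      legalLists (suc n)                          ∎
      where
      open ≡-Reasoning
      dec-value : ∀ l → LegalIndices (2 * n) l → dec (value a l) ≡ l
      dec-value l legal with dec-legal (value a l)
      ... | N , legal′ , value≡ =
        unique (N ⊔ 2 * n) _ _ (legal-weaken _ (m≤m⊔n N _) legal′) (legal-weaken _ (m≤n⊔m N _) legal) value≡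

    sum-over-dec : ∀ (f : List ℕ → ℕ) n →
      sum (map (f ∘ dec) (upTo (a (suc (2 * n))))) ≡ sum (map f (legalLists (suc n)))
    sum-over-dec f n = cong sum (trans (map-∘ (upTo (a (suc (2 * n))))) (cong (map f) (dec-enumerates n)))

sum-legalLists : ∀ (f : List ℕ → ℕ) n → sum (map f (legalLists (2 + n))) ≡
  sum (map f (legalLists (suc n))) +
  (sum (map (f ∘ (_∷ʳ suc (2 * n))) (legalLists n)) + sum (map (f ∘ (_∷ʳ (2 + 2 * n))) (legalLists n)))
sum-legalLists f n = begin
  sum (map f (L′ ++ (map (_∷ʳ x) L ++ map (_∷ʳ y) L)))
    ≡⟨ cong sum (map-++ f L′ _) ⟩
  sum (map f L′ ++ map f (map (_∷ʳ x) L ++ map (_∷ʳ y) L))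
    ≡⟨ sum-++ (map f L′) _ ⟩
  sum (map f L′) + sum (map f (map (_∷ʳ x) L ++ map (_∷ʳ y) L))
    ≡⟨ cong (λ l → sum (map f L′) + sum l) (map-++ f (map (_∷ʳ x) L) _) ⟩
  sum (map f L′) + sum (map f (map (_∷ʳ x) L) ++ map f (map (_∷ʳ y) L))
    ≡⟨ cong (sum (map f L′) +_) (sum-++ (map f (map (_∷ʳ x) L)) _) ⟩
  sum (map f L′) + (sum (map f (map (_∷ʳ x) L)) + sum (map f (map (_∷ʳ y) L)))
    ≡⟨ cong (λ v → sum (map f L′) + v) (cong₂ _+_ (cong sum (sym (map-∘ L))) (cong sum (sym (map-∘ L)))) ⟩
  sum (map f L′) + (sum (map (f ∘ (_∷ʳ x)) L) + sum (map (f ∘ (_∷ʳ y)) L)) ∎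
  where
  open ≡-Reasoning
  L′ : List (List ℕ)
  L′ = legalLists (suc n)
  L : List (List ℕ)
  L = legalLists n
  x : ℕ
  x = suc (2 * n)
  y : ℕ
  y = 2 + 2 * n

sum-map-+ : ∀ {A : Set} (f h : A → ℕ) xs → sum (map (λ x → f x + h x) xs) ≡ sum (map f xs) + sum (map h xs)
sum-map-+ f h []       = refl
sum-map-+ f h (x ∷ xs) = trans (cong (f x + h x +_) (sum-map-+ f h xs)) (+-assoc-swap (f x) (h x) _ _)
  where
  +-assoc-swap : ∀ p q r s → p + q + (r + s) ≡ p + r + (q + s)
  +-assoc-swap = solve-∀

sum-map-const : ∀ {A : Set} k (xs : List A) → sum (map (λ _ → k) xs) ≡ length xs * k
sum-map-const k []       = refl
sum-map-const k (x ∷ xs) = cong (k +_) (sum-map-const k xs)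

-- J n = |legalLists n|; these are the Jacobsthal numbers 1, 1, 3, 5, 11, 21, …
J : ℕ → ℕ
J 0             = 1
J 1             = 1
J (suc (suc n)) = J (suc n) + 2 * J n

length-legalLists : ∀ n → length (legalLists n) ≡ J n
length-legalLists 0             = refl
length-legalLists 1             = refl
length-legalLists (suc (suc n)) = begin
  length (legalLists (suc n) ++ (map (_∷ʳ x) L ++ map (_∷ʳ y) L))
    ≡⟨ length-++ (legalLists (suc n)) ⟩
  length (legalLists (suc n)) + length (map (_∷ʳ x) L ++ map (_∷ʳ y) L)
    ≡⟨ cong (length (legalLists (suc n)) +_) (length-++ (map (_∷ʳ x) L)) ⟩
  length (legalLists (suc n)) + (length (map (_∷ʳ x) L) + length (map (_∷ʳ y) L))
    ≡⟨ cong₂ (λ u v → u + (v + length (map (_∷ʳ y) L))) (length-legalLists (suc n)) (length-map (_∷ʳ x) L) ⟩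
  J (suc n) + (length L + length (map (_∷ʳ y) L))
    ≡⟨ cong (λ v → J (suc n) + (length L + v)) (trans (length-map (_∷ʳ y) L) (sym (+-identityʳ _))) ⟩
  J (suc n) + 2 * length L
    ≡⟨ cong (λ v → J (suc n) + 2 * v) (length-legalLists n) ⟩
  J (suc (suc n)) ∎
  where
  open ≡-Reasoning
  L : List (List ℕ)
  L = legalLists n
  x : ℕ
  x = suc (2 * n)
  y : ℕ
  y = 2 + 2 * n

-- Weighted gap statistics: Σ w over the gaps of a list.  The number of gaps
-- (w = 1) and the number of gaps equal to g (w = δ g) are instances.
gapWeight : (ℕ → ℕ) → List ℕ → ℕ
gapWeight w ℓs = sum (map w (gaps ℓs))

lastGapWeight : (ℕ → ℕ) → List ℕ → ℕ → ℕ
lastGapWeight w []          z = 0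
lastGapWeight w (x ∷ [])    z = w (z ∸ x)
lastGapWeight w (x ∷ y ∷ r) z = lastGapWeight w (y ∷ r) z

gapWeight-∷ʳ : ∀ w xs z → gapWeight w (xs ∷ʳ z) ≡ gapWeight w xs + lastGapWeight w xs z
gapWeight-∷ʳ w []          z = refl
gapWeight-∷ʳ w (x ∷ [])    z = +-identityʳ (w (z ∸ x))
gapWeight-∷ʳ w (x ∷ y ∷ r) z =
  trans (cong (w (y ∸ x) +_) (gapWeight-∷ʳ w (y ∷ r) z)) (sym (+-assoc (w (y ∸ x)) _ _))

lastGapWeight-∷ʳ : ∀ w xs v z → lastGapWeight w (xs ∷ʳ v) z ≡ w (z ∸ v)
lastGapWeight-∷ʳ w []          v z = refl
lastGapWeight-∷ʳ w (x ∷ [])    v z = refl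
lastGapWeight-∷ʳ w (x ∷ y ∷ r) v z = lastGapWeight-∷ʳ w (y ∷ r) v z

gapSum : (ℕ → ℕ) → ℕ → ℕ
gapSum w n = sum (map (gapWeight w) (legalLists n))

lastGapSum : (ℕ → ℕ) → ℕ → ℕ → ℕ
lastGapSum w z n = sum (map (λ xs → lastGapWeight w xs z) (legalLists n))

-- the part of gapSum w (n+2) created by the newly appended indices 2n+1, 2n+2
forcing : (ℕ → ℕ) → ℕ → ℕ
forcing w n = lastGapSum w (suc (2 * n)) n + lastGapSum w (2 + 2 * n) n

gapSum-rec : ∀ w n → gapSum w (2 + n) ≡ gapSum w (suc n) + 2 * gapSum w n + forcing w n
gapSum-rec w n = begin
  gapSum w (2 + n)
    ≡⟨ sum-legalLists (gapWeight w) n ⟩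
  gapSum w (suc n) + (appended (suc (2 * n)) + appended (2 + 2 * n))
    ≡⟨ cong (gapSum w (suc n) +_) (cong₂ _+_ (split (suc (2 * n))) (split (2 + 2 * n))) ⟩
  gapSum w (suc n) + ((gapSum w n + lastGapSum w (suc (2 * n)) n) + (gapSum w n + lastGapSum w (2 + 2 * n) n))
    ≡⟨ regroup (gapSum w (suc n)) (gapSum w n) _ _ ⟩
  gapSum w (suc n) + 2 * gapSum w n + forcing w n ∎
  where
  open ≡-Reasoning
  appended : ℕ → ℕ
  appended z = sum (map (gapWeight w ∘ (_∷ʳ z)) (legalLists n))
  split : ∀ z → appended z ≡ gapSum w n + lastGapSum w z n
  split z = trans (cong sum (map-cong (λ xs → gapWeight-∷ʳ w xs z) (legalLists n)))
                  (sum-map-+ (gapWeight w) _ (legalLists n))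
  regroup : ∀ p q r s → p + ((q + r) + (q + s)) ≡ p + 2 * q + (r + s)
  regroup = solve-∀

lastGapSum-rec : ∀ w z n → lastGapSum w z (2 + n) ≡
  lastGapSum w z (suc n) + (J n * w (z ∸ suc (2 * n)) + J n * w (z ∸ (2 + 2 * n)))
lastGapSum-rec w z n =
  trans (sum-legalLists (λ xs → lastGapWeight w xs z) n)
        (cong (lastGapSum w z (suc n) +_) (cong₂ _+_ (appended (suc (2 * n))) (appended (2 + 2 * n))))
  where
  appended : ∀ v → sum (map ((λ xs → lastGapWeight w xs z) ∘ (_∷ʳ v)) (legalLists n)) ≡ J n * w (z ∸ v)
  appended v = begin
    sum (map ((λ xs → lastGapWeight w xs z) ∘ (_∷ʳ v)) (legalLists n))
      ≡⟨ cong sum (map-cong (λ xs → lastGapWeight-∷ʳ w xs v z) (legalLists n)) ⟩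
    sum (map (λ _ → w (z ∸ v)) (legalLists n))
      ≡⟨ sum-map-const (w (z ∸ v)) (legalLists n) ⟩
    length (legalLists n) * w (z ∸ v)
      ≡⟨ cong (_* w (z ∸ v)) (length-legalLists n) ⟩
    J n * w (z ∸ v) ∎
    where open ≡-Reasoning

one : ℕ → ℕ
one _ = 1

length≡gapWeight-one : ∀ ℓs → length (gaps ℓs) ≡ gapWeight one ℓs
length≡gapWeight-one ℓs = sym (trans (sum-map-const 1 (gaps ℓs)) (*-identityʳ _))

-- Every nonempty list of legalLists n has a last gap to z.
lastGapSum-one : ∀ z n → lastGapSum one z n + 1 ≡ J n
lastGapSum-one z 0             = refl
lastGapSum-one z 1             = refl
lastGapSum-one z (suc (suc n)) = begin
  lastGapSum one z (2 + n) + 1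
    ≡⟨ cong (_+ 1) (lastGapSum-rec one z n) ⟩
  lastGapSum one z (suc n) + (J n * 1 + J n * 1) + 1
    ≡⟨ regroup (lastGapSum one z (suc n)) (J n) ⟩
  (lastGapSum one z (suc n) + 1) + 2 * J n
    ≡⟨ cong (_+ 2 * J n) (lastGapSum-one z (suc n)) ⟩
  J (2 + n) ∎
  where
  open ≡-Reasoning
  regroup : ∀ e j → e + (j * 1 + j * 1) + 1 ≡ (e + 1) + 2 * j
  regroup = solve-∀

forcing-one : ∀ n → forcing one n + 2 ≡ 2 * J n
forcing-one n = begin
  forcing one n + 2
    ≡⟨ regroup (lastGapSum one (suc (2 * n)) n) (lastGapSum one (2 + 2 * n) n) ⟩
  (lastGapSum one (suc (2 * n)) n + 1) + (lastGapSum one (2 + 2 * n) n + 1)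
    ≡⟨ cong₂ _+_ (lastGapSum-one _ n) (lastGapSum-one _ n) ⟩
  J n + J n
    ≡⟨ cong (J n +_) (sym (+-identityʳ (J n))) ⟩
  2 * J n ∎
  where
  open ≡-Reasoning
  regroup : ∀ p q → p + q + 2 ≡ (p + 1) + (q + 1)
  regroup = solve-∀

δ : ℕ → ℕ → ℕ
δ g v with g ≟ v
... | yes _ = 1
... | no  _ = 0

countGap≡gapWeight-δ : ∀ g ℓs → countGap g ℓs ≡ gapWeight (δ g) ℓs
countGap≡gapWeight-δ g ℓs = count (gaps ℓs)
  where
  count : ∀ xs → length (filter (g ≟_) xs) ≡ sum (map (δ g) xs)
  count []       = refl
  count (x ∷ xs) with g ≟ x
  ... | yes g≡x = trans (cong length (filter-accept (g ≟_) g≡x)) (cong suc (count xs))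
  ... | no  g≢x = trans (cong length (filter-reject (g ≟_) g≢x)) (count xs)

δ-self : ∀ g → δ g g ≡ 1
δ-self g with g ≟ g
... | yes _  = refl
... | no g≢g = ⊥-elim (g≢g refl)

δ-other : ∀ {g v} → g ≢ v → δ g v ≡ 0
δ-other {g} {v} g≢v with g ≟ v
... | yes g≡v = ⊥-elim (g≢v g≡v)
... | no  _   = refl

δ-hit : ∀ g y → δ g (y + g ∸ y) ≡ 1
δ-hit g y = trans (cong (δ g) (m+n∸m≡n y g)) (δ-self g)

δ-miss : ∀ {g} → 1 ≤ g → ∀ y v → v ≢ y → δ g (y + g ∸ v) ≡ 0
δ-miss {g} 1≤g y v v≢y = δ-other (λ g≡ → v≢y (same-end g≡))
  where
  same-end : g ≡ y + g ∸ v → v ≡ y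
  same-end g≡ with v ≤? y + g
  ... | yes v≤ = +-cancelʳ-≡ g v y (trans (+-comm v g) (trans (cong (_+ v) g≡) (m∸n+n≡m v≤)))
  ... | no  v≰ = ⊥-elim (<⇒≱ 1≤g (≤-reflexive (trans g≡ (m≤n⇒m∸n≡0 (<⇒≤ (≰⇒> v≰))))))

-- Counting the lists of legalLists n that end at a given index y, through the
-- gap g ≥ 1 from y to y + g.
module EndCounts (g : ℕ) (1≤g : 1 ≤ g) where

  miss : ∀ n y v → v ≢ y → J n * δ g (y + g ∸ v) ≡ 0
  miss n y v v≢y = trans (cong (J n *_) (δ-miss 1≤g y v v≢y)) (*-zeroʳ (J n))

  ends-beyond : ∀ n y → 2 * n ≤ suc y → lastGapSum (δ g) (y + g) n ≡ 0
  ends-beyond 0             y _   = refl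
  ends-beyond 1             y _   = refl
  ends-beyond (suc (suc n)) y 2n≤ = trans (lastGapSum-rec (δ g) (y + g) n)
    (cong₂ _+_ (ends-beyond (suc n) y (≤-trans (*-monoʳ-≤ 2 (n≤1+n (suc n))) 2n≤))
               (cong₂ _+_ (miss n y _ (<⇒≢ (<-trans (n<1+n _) 2n+2<y)))
                          (miss n y _ (<⇒≢ 2n+2<y))))
    where
    2n+2<y : 2 + 2 * n < y
    2n+2<y = ≤-pred (≤-trans (≤-reflexive (sym (trans (double-suc (suc n)) (cong (2 +_) (double-suc n))))) 2n≤)

  -- Exactly J k lists of legalLists (k+2) end at each index y of bin k+1:
  -- those of legalLists k extended by y.
  ends-in-last-bin : ∀ k y → suc (2 * k) ≤ y → y ≤ 2 + 2 * k → lastGapSum (δ g) (y + g) (2 + k) ≡ J k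
  ends-in-last-bin k y 2k+1≤y y≤2k+2 = trans (lastGapSum-rec (δ g) (y + g) k)
    (trans (cong (_+ new-gaps) (ends-beyond (suc k) y (≤-trans (≤-reflexive (double-suc k)) (s≤s 2k+1≤y))))
           (hit-one (m≤n⇒m<n∨m≡n y≤2k+2)))
    where
    new-gaps : ℕ
    new-gaps = J k * δ g (y + g ∸ suc (2 * k)) + J k * δ g (y + g ∸ (2 + 2 * k))
    hit-one : y < 2 + 2 * k ⊎ y ≡ 2 + 2 * k → 0 + new-gaps ≡ J k
    hit-one (inj₁ y<) with ≤-antisym (≤-pred y<) 2k+1≤y
    ... | refl = trans (cong₂ _+_ (cong (J k *_) (δ-hit g y)) (miss k y _ (λ eq → <⇒≢ (n<1+n y) (sym eq))))
                       (trans (+-identityʳ _) (*-identityʳ (J k)))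
    hit-one (inj₂ refl) = trans (cong₂ _+_ (miss k y _ (<⇒≢ (n<1+n _))) (cong (J k *_) (δ-hit g y)))
                                (*-identityʳ (J k))

  -- Later blocks add no list ending at y, so the count stays J k.
  ends-in-bin : ∀ m k y → suc (2 * k) ≤ y → y ≤ 2 + 2 * k → lastGapSum (δ g) (y + g) (2 + (m + k)) ≡ J k
  ends-in-bin zero    k y 2k+1≤y y≤2k+2 = ends-in-last-bin k y 2k+1≤y y≤2k+2
  ends-in-bin (suc m) k y 2k+1≤y y≤2k+2 = trans (lastGapSum-rec (δ g) (y + g) (suc (m + k)))
    (trans (cong₂ _+_ (ends-in-bin m k y 2k+1≤y y≤2k+2)
                      (cong₂ _+_ (miss n y _ (λ eq → <⇒≢ y<2n+1 (sym eq)))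
                                 (miss n y _ (λ eq → <⇒≢ (<-trans y<2n+1 (n<1+n _)) (sym eq)))))
           (+-identityʳ (J k)))
    where
    n : ℕ
    n = suc (m + k)
    y<2n+1 : y < suc (2 * n)
    y<2n+1 = s≤s (≤-trans y≤2k+2 (≤-trans (≤-reflexive (sym (double-suc k))) (*-monoʳ-≤ 2 (s≤s (m≤n+m k m)))))

-- Growth of the Jacobsthal numbers: J n = (2^{n+1} ± 1)/3, expressed through
-- additive closeness so that everything stays in ℕ.

Close : ℕ → ℕ → ℕ → Set
Close e x y = (x < y + e) × (y < x + e)

J-doubling : ∀ n → Close 2 (J (suc n)) (2 * J n)
J-doubling zero    = s≤s (s≤s z≤n) , s≤s (s≤s (s≤s z≤n))
J-doubling (suc n) with J-doubling n
... | J<2J+2 , 2J<J+2 = left , right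
  where
  open ≤-Reasoning
  left : J (2 + n) < 2 * J (suc n) + 2
  left = begin-strict
    J (suc n) + 2 * J n     <⟨ +-monoʳ-< (J (suc n)) 2J<J+2 ⟩
    J (suc n) + (J (suc n) + 2) ≡⟨ regroup (J (suc n)) ⟩
    2 * J (suc n) + 2       ∎
    where
    regroup : ∀ j → j + (j + 2) ≡ 2 * j + 2
    regroup = solve-∀
  right : 2 * J (suc n) < J (2 + n) + 2
  right = begin-strict
    2 * J (suc n)               ≡⟨ regroup (J (suc n)) ⟩
    J (suc n) + J (suc n)       <⟨ +-monoʳ-< (J (suc n)) J<2J+2 ⟩
    J (suc n) + (2 * J n + 2)   ≡⟨ sym (+-assoc (J (suc n)) (2 * J n) 2) ⟩
    J (2 + n) + 2               ∎
    where
    regroup : ∀ j → 2 * j ≡ j + j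
    regroup = solve-∀

Close-double : ∀ {e x y y′} → Close e x y → Close 2 y′ (2 * y) → Close (2 * e) (2 * x) y′
Close-double {e} {x} {y} {y′} (x<y+e , y<x+e) (y′<2y+2 , 2y<y′+2) = left , right
  where
  open ≤-Reasoning
  left : 2 * x < y′ + 2 * e
  left = +-cancelʳ-≤ 2 _ _ (begin
    suc (2 * x) + 2     ≡⟨ r₁ x ⟩
    suc (2 * suc x)     ≤⟨ s≤s (*-monoʳ-≤ 2 x<y+e) ⟩
    suc (2 * (y + e))   ≡⟨ r₂ y e ⟩
    suc (2 * y) + 2 * e ≤⟨ +-monoˡ-≤ (2 * e) 2y<y′+2 ⟩
    y′ + 2 + 2 * e      ≡⟨ r₃ y′ e ⟩
    y′ + 2 * e + 2      ∎)
    where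
    r₁ : ∀ x → suc (2 * x) + 2 ≡ suc (2 * suc x)
    r₁ = solve-∀
    r₂ : ∀ y e → suc (2 * (y + e)) ≡ suc (2 * y) + 2 * e
    r₂ = solve-∀
    r₃ : ∀ y′ e → y′ + 2 + 2 * e ≡ y′ + 2 * e + 2
    r₃ = solve-∀
  right : y′ < 2 * x + 2 * e
  right = begin
    suc y′          ≤⟨ y′<2y+2 ⟩
    2 * y + 2       ≡⟨ r₄ y ⟩
    2 * suc y       ≤⟨ *-monoʳ-≤ 2 y<x+e ⟩
    2 * (x + e)     ≡⟨ *-distribˡ-+ 2 x e ⟩
    2 * x + 2 * e   ∎
    where
    r₄ : ∀ y → 2 * y + 2 ≡ 2 * suc y
    r₄ = solve-∀

J-scaling : ∀ i k → Close (2 ^ i) (2 ^ i * J k) (J (i + k))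
J-scaling zero    k = subst (λ v → Close 1 v (J k)) (sym (*-identityˡ (J k))) (J<J+1 , J<J+1)
  where
  J<J+1 : J k < J k + 1
  J<J+1 = m<m+n (J k) (s≤s z≤n)
J-scaling (suc i) k =
  subst (λ v → Close (2 ^ suc i) v (J (suc i + k))) (sym (*-assoc 2 (2 ^ i) (J k)))
    (Close-double (J-scaling i k) (J-doubling (i + k)))

J-lower : ∀ k → 2 ^ suc k < J (2 + k)
J-lower zero    = s≤s (s≤s (s≤s z≤n))
J-lower (suc k) = +-cancelʳ-< 2 _ _ (begin-strict
  2 * 2 ^ suc k + 2     ≡⟨ regroup (2 ^ suc k) ⟩
  2 * suc (2 ^ suc k)   ≤⟨ *-monoʳ-≤ 2 (J-lower k) ⟩
  2 * J (2 + k)         <⟨ proj₂ (J-doubling (suc (suc k))) ⟩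
  J (3 + k) + 2         ∎)
  where
  open ≤-Reasoning
  regroup : ∀ p → 2 * p + 2 ≡ 2 * suc p
  regroup = solve-∀

Near : ℕ → ℕ → ℕ → Set
Near e x y = (x ≤ y + e) × (y ≤ x + e)

Close⇒Near : ∀ {e x y} → Close e x y → Near e x y
Close⇒Near (x<y+e , y<x+e) = <⇒≤ x<y+e , <⇒≤ y<x+e

Near-cong : ∀ {e x x′ y y′} → x ≡ x′ → y ≡ y′ → Near e x y → Near e x′ y′
Near-cong refl refl near = near

Near-trans : ∀ {e f x y z} → Near e x y → Near f y z → Near (e + f) x z
Near-trans {e} {f} {x} {y} {z} (x≤y+e , y≤x+e) (y≤z+f , z≤y+f) =
  ≤-trans x≤y+e (≤-trans (+-monoˡ-≤ e y≤z+f) (≤-reflexive (shuffle z f e))) ,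
  ≤-trans z≤y+f (≤-trans (+-monoˡ-≤ f y≤x+e) (≤-reflexive (+-assoc x e f)))
  where
  shuffle : ∀ z f e → z + f + e ≡ z + (e + f)
  shuffle = solve-∀

Near-+ : ∀ {e f x x′ y y′} → Near e x y → Near f x′ y′ → Near (e + f) (x + x′) (y + y′)
Near-+ {e} {f} {x} {x′} {y} {y′} (x≤ , y≤) (x′≤ , y′≤) =
  ≤-trans (+-mono-≤ x≤ x′≤) (≤-reflexive (shuffle y e y′ f)) ,
  ≤-trans (+-mono-≤ y≤ y′≤) (≤-reflexive (shuffle x e x′ f))
  where
  shuffle : ∀ y e y′ f → y + e + (y′ + f) ≡ y + y′ + (e + f)
  shuffle = solve-∀

Near-scale : ∀ k {e x y} → Near e x y → Near (k * e) (k * x) (k * y)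
Near-scale k {e} {x} {y} (x≤ , y≤) =
  ≤-trans (*-monoʳ-≤ k x≤) (≤-reflexive (*-distribˡ-+ k y e)) ,
  ≤-trans (*-monoʳ-≤ k y≤) (≤-reflexive (*-distribˡ-+ k x e))

-- All gap statistics solve X (n+2) = X (n+1) + 2 X n + x n
-- for some forcing x; since 2 is the dominant root, forcings that agree up to a
-- constant give solutions that agree up to O(2^n).
SolvesRec : (ℕ → ℕ) → (ℕ → ℕ) → Set
SolvesRec X x = ∀ n → X (2 + n) ≡ X (suc n) + 2 * X n + x n

SolvesRec-scale : ∀ k {X x} → SolvesRec X x → SolvesRec (λ n → k * X n) (λ n → k * x n)
SolvesRec-scale k {X} {x} rec n = trans (cong (k *_) (rec n)) (distribute k (X (suc n)) (X n) (x n))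
  where
  distribute : ∀ k a b c → k * (a + 2 * b + c) ≡ k * a + 2 * (k * b) + k * c
  distribute = solve-∀

compare-step : ∀ {X₀ X₁ X₂ Y₀ Y₁ Y₂ x y} C P →
  X₂ ≡ X₁ + 2 * X₀ + x → Y₂ ≡ Y₁ + 2 * Y₀ + y →
  X₀ + C ≤ Y₀ + P → X₁ + C ≤ Y₁ + 2 * P → x ≤ y + C →
  X₂ + C ≤ Y₂ + 2 * (2 * P)
compare-step {X₀} {X₁} {X₂} {Y₀} {Y₁} {Y₂} {x} {y} C P refl refl h₀ h₁ hx =
  +-cancelʳ-≤ C _ _ (≤-trans (+-monoʳ-≤ (X₁ + 2 * X₀ + x + C) (m≤m+n C C)) (begin
    X₁ + 2 * X₀ + x + C + (C + C)      ≡⟨ r₁ X₁ X₀ x C ⟩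
    (X₁ + C) + 2 * (X₀ + C) + x        ≤⟨ +-mono-≤ (+-mono-≤ h₁ (*-monoʳ-≤ 2 h₀)) hx ⟩
    (Y₁ + 2 * P) + 2 * (Y₀ + P) + (y + C) ≡⟨ r₂ Y₁ Y₀ y C P ⟩
    Y₁ + 2 * Y₀ + y + 2 * (2 * P) + C ∎))
  where
  open ≤-Reasoning
  r₁ : ∀ X₁ X₀ x C → X₁ + 2 * X₀ + x + C + (C + C) ≡ (X₁ + C) + 2 * (X₀ + C) + x
  r₁ = solve-∀
  r₂ : ∀ Y₁ Y₀ y C P → (Y₁ + 2 * P) + 2 * (Y₀ + P) + (y + C) ≡ Y₁ + 2 * Y₀ + y + 2 * (2 * P) + C
  r₂ = solve-∀

compare-solutions : ∀ {X Y x y} C n₀ → SolvesRec X x → SolvesRec Y y →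
  (∀ m → x (m + n₀) ≤ y (m + n₀) + C) →
  Σ ℕ λ A → ∀ m → X (m + n₀) ≤ Y (m + n₀) + A * 2 ^ (m + n₀)
compare-solutions {X} {Y} {x} {y} C n₀ rec-X rec-Y x≤y = A , λ m → m+n≤o⇒m≤o (X (m + n₀)) (proj₁ (both m))
  where
  A : ℕ
  A = X n₀ + X (suc n₀) + C
  Inv : ℕ → Set
  Inv n = X n + C ≤ Y n + A * 2 ^ n
  initial : ∀ n → X n + C ≤ A → Inv n
  initial n h = ≤-trans h (≤-trans (m≤m*n A (2 ^ n) {{m^n≢0 2 n}}) (m≤n+m _ _))
  doubling : ∀ P → A * (2 * P) ≡ 2 * (A * P)
  doubling P = trans (sym (*-assoc A 2 P)) (trans (cong (_* P) (*-comm A 2)) (*-assoc 2 A P))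
  both : ∀ m → Inv (m + n₀) × Inv (suc m + n₀)
  both zero    = initial n₀ (+-monoˡ-≤ C (m≤m+n (X n₀) _)) , initial (suc n₀) (+-monoˡ-≤ C (m≤n+m _ (X n₀)))
  both (suc m) with both m
  ... | inv₀ , inv₁ = inv₁ ,
    subst (λ v → X (2 + (m + n₀)) + C ≤ Y (2 + (m + n₀)) + v) (sym (trans (doubling (2 * P)) (cong (2 *_) (doubling P))))
      (compare-step {X₁ = X (suc m + n₀)} {Y₁ = Y (suc m + n₀)} C (A * P) (rec-X (m + n₀)) (rec-Y (m + n₀)) inv₀
        (subst (λ v → X (suc m + n₀) + C ≤ Y (suc m + n₀) + v) (doubling P) inv₁) (x≤y m))
    where
    P : ℕ
    P = 2 ^ (m + n₀)

compare-near : ∀ {X Y x y} C n₀ → SolvesRec X x → SolvesRec Y y →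
  (∀ m → Near C (x (m + n₀)) (y (m + n₀))) →
  Σ ℕ λ B → ∀ m → Near (B * 2 ^ (m + n₀)) (X (m + n₀)) (Y (m + n₀))
compare-near {X} {Y} {x} {y} C n₀ rec-X rec-Y near
  with compare-solutions {X} {Y} {x} {y} C n₀ rec-X rec-Y (proj₁ ∘ near)
     | compare-solutions {Y} {X} {y} {x} C n₀ rec-Y rec-X (proj₂ ∘ near)
... | A₁ , X≤Y | A₂ , Y≤X = A₁ + A₂ , λ m →
  ≤-trans (X≤Y m) (+-monoʳ-≤ _ (*-monoˡ-≤ (2 ^ (m + n₀)) (m≤m+n A₁ A₂))) ,
  ≤-trans (Y≤X m) (+-monoʳ-≤ _ (*-monoˡ-≤ (2 ^ (m + n₀)) (m≤n+m A₂ A₁)))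

gapSum-one-growth : ∀ m → m * 2 ^ (4 + m) ≤ 6 * gapSum one (4 + m)
gapSum-one-growth m = proj₁ (pair m)
  where
  T : ℕ → ℕ
  T = gapSum one
  new-gaps : ∀ m → 2 ^ (4 + m) ≤ forcing one (4 + m)
  new-gaps m = +-cancelʳ-≤ 2 _ _ (begin
    2 ^ (4 + m) + 2            ≡⟨ r (2 ^ (3 + m)) ⟩
    2 * suc (2 ^ (3 + m))      ≤⟨ *-monoʳ-≤ 2 (J-lower (2 + m)) ⟩
    2 * J (4 + m)              ≡⟨ sym (forcing-one (4 + m)) ⟩
    forcing one (4 + m) + 2    ∎)
    where
    open ≤-Reasoning
    r : ∀ p → 2 * p + 2 ≡ 2 * suc p
    r = solve-∀
  T₅ : 1 * 2 ^ 5 ≤ 6 * T 5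
  T₅ = toWitness {a? = 1 * 2 ^ 5 ≤? 6 * T 5} _
  step : ∀ m → m * 2 ^ (4 + m) ≤ 6 * T (4 + m) → suc m * 2 ^ (5 + m) ≤ 6 * T (5 + m) →
         suc (suc m) * 2 ^ (6 + m) ≤ 6 * T (6 + m)
  step m h₄ h₅ = begin
    suc (suc m) * (2 * (2 * P))                 ≡⟨ r₁ m P ⟩
    suc m * (2 * P) + 2 * (m * P) + 6 * P       ≤⟨ +-mono-≤ (+-mono-≤ h₅ (*-monoʳ-≤ 2 h₄)) (*-monoʳ-≤ 6 (new-gaps m)) ⟩
    6 * T (5 + m) + 2 * (6 * T (4 + m)) + 6 * forcing one (4 + m) ≡⟨ r₂ (T (5 + m)) (T (4 + m)) _ ⟩
    6 * (T (5 + m) + 2 * T (4 + m) + forcing one (4 + m))  ≡⟨ cong (6 *_) (sym (gapSum-rec one (4 + m))) ⟩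
    6 * T (6 + m)                               ∎
    where
    open ≤-Reasoning
    P : ℕ
    P = 2 ^ (4 + m)
    r₁ : ∀ m P → suc (suc m) * (2 * (2 * P)) ≡ suc m * (2 * P) + 2 * (m * P) + 6 * P
    r₁ = solve-∀
    r₂ : ∀ T₅ T₄ t → 6 * T₅ + 2 * (6 * T₄) + 6 * t ≡ 6 * (T₅ + 2 * T₄ + t)
    r₂ = solve-∀
  pair : ∀ m → (m * 2 ^ (4 + m) ≤ 6 * T (4 + m)) × (suc m * 2 ^ (5 + m) ≤ 6 * T (5 + m))
  pair zero    = z≤n , T₅
  pair (suc m) with pair m
  ... | h₄ , h₅ = h₅ , step m h₄ h₅

∣⊖∣≤ : ∀ a b E → a ≤ b + E → b ≤ a + E → ℤ.∣ a ⊖ b ∣ ≤ E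
∣⊖∣≤ a b E a≤b+E b≤a+E with ≤-total a b
... | inj₁ a≤b = subst (_≤ E) (sym (ℤP.∣⊖∣-≤ a≤b)) (m≤n+o⇒m∸n≤o b a b≤a+E)
... | inj₂ b≤a = subst (_≤ E) (sym (trans (ℤP.∣m⊖n∣≡∣n⊖m∣ a b) (ℤP.∣⊖∣-≤ b≤a))) (m≤n+o⇒m∸n≤o a b a≤b+E)

cross-difference : ∀ F q p T → (ℤ.+ F) ℤ.* (ℤ.+ q) ℤ.+ (ℤ.- (ℤ.+ p)) ℤ.* (ℤ.+ T) ≡ (F * q) ⊖ (p * T)
cross-difference F q p T =
  trans (cong₂ ℤ._+_ (sym (ℤP.pos-* F q)) (trans (sym (ℤP.neg-distribˡ-* (ℤ.+ p) (ℤ.+ T))) (cong ℤ.-_ (sym (ℤP.pos-* p T)))))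
        (ℤP.m-n≡m⊖n (F * q) (p * T))

ratio-near : ∀ F t p q′ E (L ε : ℚ) → toℚᵘ L ≃ᵘ mkℚᵘ (ℤ.+ p) q′ → 0ℚ ℚ.< ε →
  Near E (F * suc q′) (p * suc t) → E * ↧ₙ ε < suc t →
  ℚ.∣ (ℤ.+ F) / suc t ℚ.- L ∣ ℚ.< ε
ratio-near F t p q′ E L ε@(mkℚ +[1+ k ] d _) L≃p/q _ (Fq≤ , pT≤) E-small =
  ℚP.toℚᵘ-cancel-< (ℚᵘP.<-respˡ-≃ (ℚᵘP.≃-sym as-unnormalised) core)
  where
  F/T p/q : ℚᵘ
  F/T = mkℚᵘ (ℤ.+ F) t
  p/q = mkℚᵘ (ℤ.+ p) q′
  as-unnormalised : toℚᵘ (ℚ.∣ (ℤ.+ F) / suc t ℚ.- L ∣) ≃ᵘ ℚᵘ.∣ F/T ℚᵘ.+ (ℚᵘ.- p/q) ∣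
  as-unnormalised = ℚᵘP.≃-trans (ℚP.toℚᵘ-homo-∣-∣ ((ℤ.+ F) / suc t ℚ.- L))
    (ℚᵘP.∣-∣-cong (ℚᵘP.≃-trans (ℚP.toℚᵘ-homo-+ ((ℤ.+ F) / suc t) (ℚ.- L))
      (ℚᵘP.+-cong (ℚP.toℚᵘ-fromℚᵘ F/T) (ℚᵘP.≃-trans (ℚP.toℚᵘ-homo‿- L) (ℚᵘP.-‿cong L≃p/q)))))
  distance : ℕ
  distance = ℤ.∣ (F * suc q′) ⊖ (p * suc t) ∣
  cross-bound : distance * suc d < suc k * (suc t * suc q′)
  cross-bound = <-≤-trans (≤-<-trans (*-monoˡ-≤ (suc d) (∣⊖∣≤ _ _ E Fq≤ pT≤)) E-small)
    (≤-trans (m≤m*n (suc t) (suc q′)) (m≤n*m (suc t * suc q′) (suc k)))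
  core : ℚᵘ.∣ F/T ℚᵘ.+ (ℚᵘ.- p/q) ∣ <ᵘ toℚᵘ ε
  core = *<* (subst₂ ℤ._<_
    (trans (ℤP.pos-* distance (suc d)) (cong (λ z → ℤ.+ ℤ.∣ z ∣ ℤ.* ℤ.+ suc d) (sym (cross-difference F (suc q′) p (suc t)))))
    (ℤP.pos-* (suc k) (suc t * suc q′))
    (ℤ.+<+ cross-bound))
ratio-near F t p q′ E L (mkℚ (ℤ.+ 0) d _)     _ 0<ε _ _ with ℚP.toℚᵘ-mono-< 0<ε
... | *<* (ℤ.+<+ ())
ratio-near F t p q′ E L (mkℚ -[1+ k ] d _)  _ 0<ε _ _ with ℚP.toℚᵘ-mono-< 0<ε
... | *<* ()

growth-beats : ∀ (T : ℕ → ℕ) → (∀ m → m * 2 ^ (4 + m) ≤ 6 * T (4 + m)) →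
  ∀ K n → suc (6 * K) + 4 ≤ n → K * 2 ^ n < T n
growth-beats T growth K n n≥ = *-cancelˡ-< 6 _ _ (begin-strict
  6 * (K * P)         ≡⟨ sym (*-assoc 6 K P) ⟩
  6 * K * P           <⟨ +-monoˡ-< (6 * K * P) (m^n>0 2 n) ⟩
  suc (6 * K) * P     ≤⟨ *-monoˡ-≤ P 6K<m ⟩
  m * P               ≡⟨ cong (λ v → m * 2 ^ v) (sym 4+m≡n) ⟩
  m * 2 ^ (4 + m)     ≤⟨ growth m ⟩
  6 * T (4 + m)       ≡⟨ cong (λ v → 6 * T v) 4+m≡n ⟩
  6 * T n             ∎)
  where
  open ≤-Reasoning
  P : ℕ
  P = 2 ^ n
  m : ℕ
  m = n ∸ 4
  4+m≡n : 4 + m ≡ n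
  4+m≡n = m+[n∸m]≡n (≤-trans (m≤n+m 4 (suc (6 * K))) n≥)
  6K<m : suc (6 * K) ≤ m
  6K<m = m+n≤o⇒m≤o∸n (suc (6 * K)) n≥

ratio-converges : ∀ (F T : ℕ → ℕ) p q′ n₀ B (L : ℚ) → toℚᵘ L ≃ᵘ mkℚᵘ (ℤ.+ p) q′ →
  (∀ m → m * 2 ^ (4 + m) ≤ 6 * T (4 + m)) →
  (∀ m → Near (B * 2 ^ (m + n₀)) (suc q′ * F (m + n₀)) (p * T (m + n₀))) →
  (s : ℕ → ℚ) → (∀ n t → T (suc n) ≡ suc t → s n ≡ (ℤ.+ F (suc n)) / suc t) →
  ConvergesTo s L
ratio-converges F T p q′ n₀ B L L≃p/q growth near s s≡ ε 0<ε = 6 * K + 4 + n₀ , converges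
  where
  K : ℕ
  K = B * ↧ₙ ε
  converges : ∀ n → 6 * K + 4 + n₀ ≤ n → ℚ.∣ s n ℚ.- L ∣ ℚ.< ε
  converges n N≤n with T (suc n) in T≡ | growth-beats T growth K (suc n) (s≤s (≤-trans (m≤m+n _ n₀) N≤n))
  ... | zero  | K2ⁿ<T = ⊥-elim (<⇒≱ K2ⁿ<T z≤n)
  ... | suc t | K2ⁿ<T = subst (λ v → ℚ.∣ v ℚ.- L ∣ ℚ.< ε) (sym (s≡ n t T≡))
    (ratio-near (F (suc n)) t p q′ (B * 2 ^ suc n) L ε L≃p/q 0<ε
      (Near-cong (*-comm (suc q′) (F (suc n))) (cong (p *_) T≡) near-n)
      (subst (_< suc t) (swap B (↧ₙ ε) (2 ^ suc n)) K2ⁿ<T))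
    where
    k : ℕ
    k = suc n ∸ n₀
    k+n₀≡ : k + n₀ ≡ suc n
    k+n₀≡ = m∸n+n≡m (≤-trans (m≤n+m n₀ _) (m≤n⇒m≤1+n N≤n))
    near-n : Near (B * 2 ^ suc n) (suc q′ * F (suc n)) (p * T (suc n))
    near-n = subst (λ v → Near (B * 2 ^ v) (suc q′ * F v) (p * T v)) k+n₀≡ (near k)
    swap : ∀ b d P → b * d * P ≡ b * P * d
    swap = solve-∀

forcing-one-near : ∀ n → Near 2 (2 * J n) (forcing one n)
forcing-one-near n = ≤-reflexive (sym (forcing-one n)) ,
  ≤-trans (m+n≤o⇒m≤o (forcing one n) (≤-reflexive (forcing-one n))) (m≤m+n (2 * J n) 2)

-- The forcing of the count of gaps g in the three residue cases: a new gap g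
-- ending at 2n+1 or 2n+2 starts at 2n+1−g or 2n+2−g, and EndCounts counts the
-- lists ending there.
forcing-even : ∀ i m → forcing (δ (4 + 2 * i)) (m + (2 + i)) ≡ J m + J m
forcing-even i m = cong₂ _+_
  (subst₂ (λ z n → lastGapSum (δ g) z n ≡ J m) (sym (z₁ m i)) (sym (n≡ m i))
     (ends-in-bin i m (suc (2 * m)) ≤-refl (n≤1+n _)))
  (subst₂ (λ z n → lastGapSum (δ g) z n ≡ J m) (sym (z₂ m i)) (sym (n≡ m i))
     (ends-in-bin i m (2 + 2 * m) (n≤1+n _) ≤-refl))
  where
  g : ℕ
  g = 4 + 2 * i
  open EndCounts g (s≤s z≤n)
  z₁ : ∀ m i → suc (2 * (m + (2 + i))) ≡ suc (2 * m) + (4 + 2 * i)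
  z₁ = solve-∀
  z₂ : ∀ m i → 2 + 2 * (m + (2 + i)) ≡ (2 + 2 * m) + (4 + 2 * i)
  z₂ = solve-∀
  n≡ : ∀ m i → m + (2 + i) ≡ 2 + (i + m)
  n≡ = solve-∀

forcing-odd : ∀ i m → forcing (δ (5 + 2 * i)) (m + (3 + i)) ≡ J m + J (suc m)
forcing-odd i m = cong₂ _+_
  (subst₂ (λ z n → lastGapSum (δ g) z n ≡ J m) (sym (z₁ m i)) (sym (n₁ m i))
     (ends-in-bin (suc i) m (2 + 2 * m) (n≤1+n _) ≤-refl))
  (subst₂ (λ z n → lastGapSum (δ g) z n ≡ J (suc m)) (sym (z₂ m i)) (sym (n₂ m i))
     (ends-in-bin i (suc m) (suc (2 * suc m)) ≤-refl (n≤1+n _)))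
  where
  g : ℕ
  g = 5 + 2 * i
  open EndCounts g (s≤s z≤n)
  z₁ : ∀ m i → suc (2 * (m + (3 + i))) ≡ (2 + 2 * m) + (5 + 2 * i)
  z₁ = solve-∀
  z₂ : ∀ m i → 2 + 2 * (m + (3 + i)) ≡ suc (2 * suc m) + (5 + 2 * i)
  z₂ = solve-∀
  n₁ : ∀ m i → m + (3 + i) ≡ 2 + (suc i + m)
  n₁ = solve-∀
  n₂ : ∀ m i → m + (3 + i) ≡ 2 + (i + suc m)
  n₂ = solve-∀

forcing-three : ∀ m → forcing (δ 3) (m + 2) ≡ J m
forcing-three m = trans (cong₂ _+_
  (subst₂ (λ z n → lastGapSum (δ 3) z n ≡ J m) (sym (z₁ m)) (+-comm 2 m)
     (ends-in-bin 0 m (2 + 2 * m) (n≤1+n _) ≤-refl))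
  (subst₂ (λ z n → lastGapSum (δ 3) z n ≡ 0) (sym (z₂ m)) (+-comm 2 m)
     (ends-beyond (2 + m) (3 + 2 * m) (≤-reflexive (n≡ m)))))
  (+-identityʳ (J m))
  where
  open EndCounts 3 (s≤s z≤n)
  z₁ : ∀ m → suc (2 * (m + 2)) ≡ (2 + 2 * m) + 3
  z₁ = solve-∀
  z₂ : ∀ m → 2 + 2 * (m + 2) ≡ (3 + 2 * m) + 3
  z₂ = solve-∀
  n≡ : ∀ m → 2 * (2 + m) ≡ suc (3 + 2 * m)
  n≡ = solve-∀

-- In each case q · (forcing of gaps g) and p · (total forcing) differ by O(1),
-- where p/q is the claimed limit; this is where J (j + m) ≈ 2^j J m enters.
near-even : ∀ i m → let P = 2 ^ (2 + i); n = m + (2 + i) in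
  Near (2 * P + 2) (P * forcing (δ (4 + 2 * i)) n) (1 * forcing one n)
near-even i m = Near-cong (sym lhs≡) (sym (*-identityˡ _)) (Near-trans scaled (forcing-one-near n))
  where
  j : ℕ
  j = 2 + i
  n : ℕ
  n = m + j
  P : ℕ
  P = 2 ^ j
  scaled : Near (2 * P) (2 * (P * J m)) (2 * J n)
  scaled = Near-scale 2 (Near-cong refl (cong J (+-comm j m)) (Close⇒Near (J-scaling j m)))
  regroup : ∀ P a → P * (a + a) ≡ 2 * (P * a)
  regroup = solve-∀
  lhs≡ : P * forcing (δ (4 + 2 * i)) n ≡ 2 * (P * J m)
  lhs≡ = trans (cong (P *_) (forcing-even i m)) (regroup P (J m))

near-odd : ∀ i m → let P = 2 ^ (2 + i); n = m + (3 + i) in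
  Near (2 * (2 * P) + 4 * P + 3 * 2) (2 ^ (2 + (2 + i)) * forcing (δ (5 + 2 * i)) n) (3 * forcing one n)
near-odd i m = Near-cong (sym lhs≡) refl
  (Near-trans (Near-cong refl (sum≡ (J n)) (Near-+ first second)) (Near-scale 3 (forcing-one-near n)))
  where
  j : ℕ
  j = 2 + i
  n : ℕ
  n = m + (3 + i)
  P : ℕ
  P = 2 ^ j
  first : Near (2 * (2 * P)) (2 * ((2 * P) * J m)) (2 * J n)
  first = Near-scale 2 (Near-cong refl (cong J (+-comm (suc j) m)) (Close⇒Near (J-scaling (suc j) m)))
  second : Near (4 * P) (4 * (P * J (suc m))) (4 * J n)
  second = Near-scale 4 (Near-cong refl (cong J (shift i m)) (Close⇒Near (J-scaling j (suc m))))
    where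
    shift : ∀ i m → (2 + i) + suc m ≡ m + (3 + i)
    shift = solve-∀
  sum≡ : ∀ x → 2 * x + 4 * x ≡ 3 * (2 * x)
  sum≡ = solve-∀
  regroup : ∀ P a b → (2 * (2 * P)) * (a + b) ≡ 2 * ((2 * P) * a) + 4 * (P * b)
  regroup = solve-∀
  lhs≡ : 2 ^ (2 + j) * forcing (δ (5 + 2 * i)) n ≡ 2 * ((2 * P) * J m) + 4 * (P * J (suc m))
  lhs≡ = trans (cong (2 ^ (2 + j) *_) (forcing-odd i m)) (regroup P (J m) (J (suc m)))

near-three : ∀ m → Near (2 * 4 + 2) (8 * forcing (δ 3) (m + 2)) (1 * forcing one (m + 2))
near-three m = Near-cong (sym lhs≡) (sym (*-identityˡ _)) (Near-trans scaled (forcing-one-near (m + 2)))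
  where
  scaled : Near (2 * 4) (2 * (4 * J m)) (2 * J (m + 2))
  scaled = Near-scale 2 (Near-cong refl (cong J (+-comm 2 m)) (Close⇒Near (J-scaling 2 m)))
  regroup : ∀ a → 8 * a ≡ 2 * (4 * a)
  regroup = solve-∀
  lhs≡ : 8 * forcing (δ 3) (m + 2) ≡ 2 * (4 * J m)
  lhs≡ = trans (cong (8 *_) (forcing-three m)) (regroup (J m))

four+double : ∀ i → 4 + 2 * i ≡ 2 * (2 + i)
four+double i = sym (trans (double-suc (suc i)) (cong (2 +_) (double-suc i)))

Plim-even : ∀ i → Plim (4 + 2 * i) ≡ _/_ (ℤ.+ 1) (2 ^ (2 + i)) {{m^n≢0 2 (2 + i)}}
Plim-even i with ⌊ 2 * i /2⌋ | half-double i | (4 + 2 * i) % 2 | parity-even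
  where
  half-double : ∀ i → ⌊ 2 * i /2⌋ ≡ i
  half-double i = trans (cong ⌊_/2⌋ (cong (i +_) (+-identityʳ i))) (sym (n≡⌊n+n/2⌋ i))
  parity-even : (4 + 2 * i) % 2 ≡ 0
  parity-even = trans (cong (_% 2) (trans (four+double i) (*-comm 2 (2 + i)))) (m*n%n≡0 (2 + i) 2)
... | .i | refl | .0 | refl = refl

Plim-odd : ∀ i → Plim (5 + 2 * i) ≡ _/_ (ℤ.+ 3) (2 ^ (2 + (2 + i))) {{m^n≢0 2 (2 + (2 + i))}}
Plim-odd i with ⌊ suc (2 * i) /2⌋ | half-double+1 i | (5 + 2 * i) % 2 | parity-odd
  where
  half-double+1 : ∀ i → ⌊ suc (2 * i) /2⌋ ≡ i
  half-double+1 zero    = refl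
  half-double+1 (suc i) = trans (cong (⌊_/2⌋ ∘ suc) (double-suc i)) (cong suc (half-double+1 i))
  parity-odd : (5 + 2 * i) % 2 ≡ 1
  parity-odd = trans (cong (λ v → suc v % 2) (trans (four+double i) (*-comm 2 (2 + i)))) ([m+kn]%n≡m%n 1 (2 + i) 2)
... | .i | refl | .1 | refl = refl

even-or-odd : ∀ k → Σ ℕ λ i → (k ≡ 2 * i) ⊎ (k ≡ suc (2 * i))
even-or-odd zero    = 0 , inj₁ refl
even-or-odd (suc k) with even-or-odd k
... | i , inj₁ refl = i , inj₂ refl
... | i , inj₂ refl = suc i , inj₁ (sym (double-suc i))

module GapDistribution (a : ℕ → ℕ) (dec : ℕ → List ℕ) (K : IsKentucky2 a)
                       (dec-legal : (m : ℕ) → LegalDecomp a (dec m) m) where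
  open Enumeration a K

  totalGaps≡ : ∀ n → totalGaps a dec n ≡ gapSum one (suc n)
  totalGaps≡ n = trans (sum-over-dec dec dec-legal (length ∘ gaps) n)
                       (cong sum (map-cong length≡gapWeight-one (legalLists (suc n))))

  gapCount≡ : ∀ n g → gapCount a dec n g ≡ sum (map (countGap g) (legalLists (suc n)))
  gapCount≡ n g = sum-over-dec dec dec-legal (countGap g) n

  Pn≡ : ∀ g n t → gapSum one (suc n) ≡ suc t → Pn a dec n g ≡ (ℤ.+ gapSum (δ g) (suc n)) / suc t
  Pn≡ g n t T≡ = trans (Pn-at (trans (totalGaps≡ n) T≡))
    (cong (λ v → (ℤ.+ v) / suc t) (trans (gapCount≡ n g) (cong sum (map-cong (countGap≡gapWeight-δ g) (legalLists (suc n))))))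
    where
    Pn-at : totalGaps a dec n ≡ suc t → Pn a dec n g ≡ (ℤ.+ gapCount a dec n g) / suc t
    Pn-at eq with totalGaps a dec n | eq
    ... | .(suc t) | refl = refl

  converges-by-forcing : ∀ g p q .{{_ : ℕ.NonZero q}} n₀ C → Plim g ≡ (ℤ.+ p) / q →
    (∀ m → Near C (q * forcing (δ g) (m + n₀)) (p * forcing one (m + n₀))) →
    ConvergesTo (λ n → Pn a dec n g) (Plim g)
  converges-by-forcing g p q@(suc q′) n₀ C Plim≡ near-forcing
    with compare-near {λ n → q * gapSum (δ g) n} {λ n → p * gapSum one n} C n₀
           (SolvesRec-scale q {gapSum (δ g)} {forcing (δ g)} (gapSum-rec (δ g)))
           (SolvesRec-scale p {gapSum one} {forcing one} (gapSum-rec one)) near-forcing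
  ... | B , near = ratio-converges (gapSum (δ g)) (gapSum one) p q′ n₀ B (Plim g)
    (subst (λ L → toℚᵘ L ≃ᵘ mkℚᵘ (ℤ.+ p) q′) (sym Plim≡) (ℚP.toℚᵘ-fromℚᵘ (mkℚᵘ (ℤ.+ p) q′)))
    gapSum-one-growth near (λ n → Pn a dec n g) (Pn≡ g)

  converges-small : ∀ g → g ≤ 2 → Plim g ≡ 0ℚ → ConvergesTo (λ n → Pn a dec n g) (Plim g)
  converges-small g g≤2 Plim≡0 ε 0<ε = 0 , λ n _ →
    subst (λ v → ℚ.∣ v ℚ.- Plim g ∣ ℚ.< ε) (sym (Pn≡0 n))
      (subst (λ v → ℚ.∣ 0ℚ ℚ.- v ∣ ℚ.< ε) (sym Plim≡0) (subst (λ v → ℚ.∣ v ∣ ℚ.< ε) (sym (ℚP.+-inverseʳ 0ℚ)) 0<ε))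
    where
    no-gaps : ∀ n → gapCount a dec n g ≡ 0
    no-gaps n = trans (gapCount≡ n g)
      (sum-zero (All.map (λ legal → countGap-small g g≤2 (proj₂ legal)) (legalLists-legal (suc n))))
      where
      sum-zero : ∀ {ls} → All (λ l → countGap g l ≡ 0) ls → sum (map (countGap g) ls) ≡ 0
      sum-zero []       = refl
      sum-zero (z ∷ zs) = cong₂ _+_ z (sum-zero zs)
    Pn≡0 : ∀ n → Pn a dec n g ≡ 0ℚ
    Pn≡0 n with totalGaps a dec n
    ... | zero  = refl
    ... | suc t rewrite no-gaps n = ℚP.0/n≡0 (suc t)

  converges : (g : ℕ) → ConvergesTo (λ n → Pn a dec n g) (Plim g)
  converges 0 = converges-small 0 z≤n refl
  converges 1 = converges-small 1 (s≤s z≤n) refl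
  converges 2 = converges-small 2 (s≤s (s≤s z≤n)) refl
  converges 3 = converges-by-forcing 3 1 8 2 (2 * 4 + 2) refl near-three
  converges (suc (suc (suc (suc k)))) with even-or-odd k
  ... | i , inj₁ refl = converges-by-forcing (4 + 2 * i) 1 (2 ^ (2 + i)) {{m^n≢0 2 (2 + i)}} (2 + i) _ (Plim-even i) (near-even i)
  ... | i , inj₂ refl = converges-by-forcing (5 + 2 * i) 3 (2 ^ (2 + (2 + i))) {{m^n≢0 2 (2 + (2 + i))}} (3 + i) _ (Plim-odd i) (near-odd i)

theorem1p4 : (a : ℕ → ℕ) (dec : ℕ → List ℕ) →
    IsKentucky2 a →
    ((m : ℕ) → LegalDecomp a (dec m) m) →
    (g : ℕ) → ConvergesTo (λ n → Pn a dec n g) (Plim g)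
theorem1p4 a dec K dec-legal = GapDistribution.converges a dec K dec-legal
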